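{- In the $\ell$-variant cup game (for any positive integer $\ell$), in any state reachable from the all-zero state, if some cup has fill $k$ for an integer $k \ge 3$, then some cup has fill $k-1$ or $k-2$.
   Context: The $\ell$-variant cup game on $n$ cups: the fills are integers, all initially $0$. In each round, the player chooses an integer $k_0 \ge 0$ and an integer $q \ge 1$ such that at least $2q$ cups have fill exactly $k_0$; then $q$ of these cups are raised to fill $k_0+1$, and $q$ other cups among them are lowered to $k_0 - 1$, except that if $k_0$ is a multiple of $\ell$ (a checkpoint) these $q$ other cups instead stay at $k_0$. If no valid choice exists the game ends. -}

module Defs where

open import Data.Nat using (ℕ; suc; _+_; _∸_; _≤_)
open import Data.Nat.Divisibility using (_∣_)
open import Data.Fin using (Fin)
open import Data.Fin.Subset using (Subset; _∈_; _∉_; ∣_∣)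
open import Data.Product using (Σ; _×_; ∃)
open import Relation.Nullary using (¬_)
open import Relation.Binary.PropositionalEquality using (_≡_)
open import Relation.Binary.Construct.Closure.ReflexiveTransitive using (Star)

-- A state of the game on n cups: the fill of each cup.
-- (Fills stay ≥ 0 because 0 is always a checkpoint, so ℕ suffices; a
-- lowering move only happens when k₀ is not a multiple of ℓ, hence k₀ ≥ 1,
-- so k₀ ∸ 1 is the true k₀ - 1.)
State : ℕ → Set
State n = Fin n → ℕ

initial : ∀ {n} → State n
initial _ = 0

record Move (ℓ : ℕ) {n : ℕ} (s s' : State n) : Set where
  field
    k₀      : ℕ
    q       : ℕ
    q≥1     : 1 ≤ q
    U D     : Subset n
    ∣U∣≡q   : ∣ U ∣ ≡ q
    ∣D∣≡q   : ∣ D ∣ ≡ q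
    disjoint : ∀ i → i ∈ U → i ∉ D
    U-fill  : ∀ i → i ∈ U → s i ≡ k₀
    D-fill  : ∀ i → i ∈ D → s i ≡ k₀
    U-new   : ∀ i → i ∈ U → s' i ≡ suc k₀
    D-check : ∀ i → i ∈ D → ℓ ∣ k₀ → s' i ≡ k₀
    D-lower : ∀ i → i ∈ D → ¬ (ℓ ∣ k₀) → s' i ≡ k₀ ∸ 1
    rest    : ∀ i → i ∉ U → i ∉ D → s' i ≡ s i

Reachable : (ℓ : ℕ) {n : ℕ} → State n → Set
Reachable ℓ s = Star (Move ℓ) initial s

{-# OPTIONS --safe #-}
-- Call a state grounded if for every occupied level v + 1 the level v or
-- v - 1 is occupied as well.  The all-zero state is grounded, and a round at
-- level k₀ only moves cups sitting at k₀, so every occupied level other than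
-- k₀ stays occupied.  Support through level k₀ is restored by the round
-- itself: it leaves a cup at k₀ + 1 and one at k₀ or k₀ - 1, which support
-- the levels k₀ + 1 and k₀ + 2, and a cup lowered to k₀ - 1 ≥ 1 is supported
-- by whatever supported level k₀ before the round.
module Submission where

open import Defs
open import Data.Nat using (ℕ; zero; suc; _≤_; _∸_; s≤s)
open import Data.Nat.Properties using (suc-injective; m≢1+n+m)
open import Data.Nat.Divisibility using (_∣?_)
open import Data.Fin using (Fin)
open import Data.Fin.Subset using (Subset; ∣_∣; Nonempty)
open import Data.Fin.Subset.Properties using (_∈?_; nonempty?; Empty-unique; ∣⊥∣≡0)
open import Data.Product using (∃; _,_; map₂)
open import Data.Sum using (_⊎_; inj₁; inj₂; [_,_])
open import Data.Empty using (⊥; ⊥-elim)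
open import Relation.Nullary using (yes; no)
open import Relation.Nullary.Decidable using (decidable-stable)
open import Relation.Binary.PropositionalEquality using (_≡_; refl; sym; trans; subst)
open import Relation.Binary.Construct.Closure.ReflexiveTransitive using (Star; ε; _◅_)

nonempty-if-size≥1 : ∀ {n} (p : Subset n) → 1 ≤ ∣ p ∣ → Nonempty p
nonempty-if-size≥1 {n} p 1≤∣p∣ = decidable-stable (nonempty? p) λ empty →
  1≰0 (subst (1 ≤_) (∣⊥∣≡0 n) (subst (λ p → 1 ≤ ∣ p ∣) (Empty-unique empty) 1≤∣p∣))
  where
  1≰0 : 1 ≤ 0 → ⊥
  1≰0 ()

∸1≡suc⇒≡2+ : ∀ m v → m ∸ 1 ≡ suc v → m ≡ suc (suc v)
∸1≡suc⇒≡2+ (suc m) v refl = refl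

Occupied : ∀ {n} → State n → ℕ → Set
Occupied s v = ∃ λ j → s j ≡ v

Supported : ∀ {n} → State n → ℕ → Set
Supported s v = Occupied s (v ∸ 1) ⊎ Occupied s (v ∸ 2)

Grounded : ∀ {n} → State n → Set
Grounded s = ∀ v → Occupied s (suc v) → Supported s (suc v)

initial-grounded : ∀ {n} → Grounded (initial {n})
initial-grounded v (_ , ())

module _ {ℓ n} {s s' : State n} (m : Move ℓ s s') where
  open Move m

  data Fate (i : Fin n) : Set where
    unchanged : s' i ≡ s i → Fate i
    raised    : s i ≡ k₀ → s' i ≡ suc k₀ → Fate i
    lowered   : s i ≡ k₀ → s' i ≡ k₀ ∸ 1 → Fate i

  fate : ∀ i → Fate i
  fate i with i ∈? U | i ∈? D
  ... | yes i∈U | _     = raised (U-fill i i∈U) (U-new i i∈U)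
  ... | no i∉U | no i∉D = unchanged (rest i i∉U i∉D)
  ... | no _ | yes i∈D with ℓ ∣? k₀
  ...   | yes ℓ∣k₀ = unchanged (trans (D-check i i∈D ℓ∣k₀) (sym (D-fill i i∈D)))
  ...   | no ℓ∤k₀  = lowered (D-fill i i∈D) (D-lower i i∈D ℓ∤k₀)

  occupied-persists : ∀ {w} → Occupied s w → Occupied s' w ⊎ w ≡ k₀
  occupied-persists (j , sj≡w) with fate j
  ... | unchanged s'j≡sj = inj₁ (j , trans s'j≡sj sj≡w)
  ... | raised sj≡k₀ _   = inj₂ (trans (sym sj≡w) sj≡k₀)
  ... | lowered sj≡k₀ _  = inj₂ (trans (sym sj≡w) sj≡k₀)

  level-above-occupied : Occupied s' (suc k₀)
  level-above-occupied with nonempty-if-size≥1 U (subst (1 ≤_) (sym ∣U∣≡q) q≥1)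
  ... | u , u∈U = u , U-new u u∈U

  level-above-supported : Supported s' (suc k₀)
  level-above-supported with nonempty-if-size≥1 D (subst (1 ≤_) (sym ∣D∣≡q) q≥1)
  ... | d , d∈D with ℓ ∣? k₀
  ...   | yes ℓ∣k₀ = inj₁ (d , D-check d d∈D ℓ∣k₀)
  ...   | no ℓ∤k₀  = inj₂ (d , D-lower d d∈D ℓ∤k₀)

  support-persists : ∀ v → Supported s (suc v) → Supported s' (suc v)
  support-persists v (inj₁ occ) with occupied-persists occ
  ... | inj₁ occ' = inj₁ occ'
  ... | inj₂ refl = level-above-supported
  support-persists zero (inj₂ occ) = support-persists zero (inj₁ occ)
  support-persists (suc v) (inj₂ occ) with occupied-persists occ
  ... | inj₁ occ' = inj₂ occ'
  ... | inj₂ refl = inj₁ level-above-occupied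

  lowered-supported : Grounded s → ∀ {i} v → s i ≡ k₀ → k₀ ≡ suc (suc v) →
                      Supported s' (suc v)
  lowered-supported G {i} v si≡k₀ k₀≡2+v with G (suc v) (i , trans si≡k₀ k₀≡2+v)
  ... | inj₁ occ = support-persists v (G v occ)
  ... | inj₂ occ with occupied-persists occ
  ...   | inj₁ occ'   = inj₁ occ'
  ...   | inj₂ v≡k₀   = ⊥-elim (m≢1+n+m v (trans v≡k₀ k₀≡2+v))

  grounded-preserved : Grounded s → Grounded s'
  grounded-preserved G v (i , s'i≡1+v) with fate i
  ... | unchanged s'i≡si = support-persists v (G v (i , trans (sym s'i≡si) s'i≡1+v))
  ... | raised _ s'i≡1+k₀ =
    subst (λ w → Supported s' (suc w)) (suc-injective (trans (sym s'i≡1+k₀) s'i≡1+v))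
          level-above-supported
  ... | lowered si≡k₀ s'i≡k₀∸1 =
    lowered-supported G v si≡k₀ (∸1≡suc⇒≡2+ k₀ v (trans (sym s'i≡k₀∸1) s'i≡1+v))

reachable-grounded : ∀ {ℓ n} {s : State n} → Reachable ℓ s → Grounded s
reachable-grounded = go initial-grounded
  where
  go : ∀ {ℓ n} {s t : State n} → Grounded s → Star (Move ℓ) s t → Grounded t
  go G ε        = G
  go G (m ◅ ms) = go (grounded-preserved m G) ms

proposition6p5 : (ℓ : ℕ) → 1 ≤ ℓ → (n : ℕ) → (s : State n) → Reachable ℓ s →
    (k : ℕ) → 3 ≤ k → (i : Fin n) → s i ≡ k →
    ∃ λ (j : Fin n) → (s j ≡ k ∸ 1) ⊎ (s j ≡ k ∸ 2)
proposition6p5 ℓ _ n s r (suc k) (s≤s _) i si≡1+k =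
  [ map₂ inj₁ , map₂ inj₂ ] (reachable-grounded r k (i , si≡1+k))
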